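{- Let $F$ be a field, $n\in\mathbb{N}$, and let $p,q\in\mathbb{N}$ satisfy $p+q\leq n+1$. If $x\in F^{n+1}$ satisfies $\operatorname{rank}(H_{p,q-1}(x))\leq p$ and $\operatorname{rank}(H_{p-1,q}(x))\leq q$, then $\operatorname{rank}(H_{p,q-1}(x))=\operatorname{rank}(H_{p-1,q}(x))$.
   Context: $\mathbb{N}=\{0,1,2,\ldots\}$. For $x=(x_0,x_1,\ldots,x_n)\in F^{n+1}$ and integers $p,s\in\{ -1,0,1,\ldots\}$ with $p+s\leq n$, $H_{p,s}(x)$ is the $(p+1)\times(s+1)$ matrix $(x_{i+j})_{0\leq i\leq p,\ 0\leq j\leq s}$ (an empty matrix, of rank $0$, if $p=-1$ or $s=-1$). -}

module Defs where

open import Level using (Level; _⊔_)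
open import Algebra.Bundles using (CommutativeRing)
open import Data.Nat as ℕ using (ℕ; zero; suc; _+_; _≤_; _<_; s≤s; z≤n)
open import Data.Nat.Properties as ℕP
open import Data.Fin using (Fin; toℕ; fromℕ<)
open import Data.Fin.Properties using (toℕ<n)
open import Data.Product using (Σ; _×_; _,_; ∃)
open import Relation.Nullary using (¬_)
open import Relation.Binary.PropositionalEquality using (sym)

record Field (c ℓ : Level) : Set (Level.suc (c ⊔ ℓ)) where
  field
    commutativeRing : CommutativeRing c ℓ
  open CommutativeRing commutativeRing public
  field
    0≉1     : ¬ (0# ≈ 1#)
    inverse : ∀ a → ¬ (a ≈ 0#) → Σ Carrier (λ b → (a * b) ≈ 1#)

module _ {c ℓ : Level} (F : Field c ℓ) where
  open Field F using (Carrier; _≈_; 0#) renaming (_+_ to _+F_; _*_ to _*F_)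

  Matrix : ℕ → ℕ → Set c
  Matrix m k = Fin m → Fin k → Carrier

  ∑ : (k : ℕ) → (Fin k → Carrier) → Carrier
  ∑ zero    f = 0#
  ∑ (suc k) f = f Fin.zero +F ∑ k (λ j → f (Fin.suc j))

  LinIndep : {m r : ℕ} → (Fin r → Fin m → Carrier) → Set (c ⊔ ℓ)
  LinIndep {m} {r} v =
    (coef : Fin r → Carrier) →
    (∀ i → ∑ r (λ j → coef j *F v j i) ≈ 0#) →
    ∀ j → coef j ≈ 0#

  col : {m k : ℕ} → Matrix m k → Fin k → Fin m → Carrier
  col M j i = M i j

  HasRank : {m k : ℕ} → Matrix m k → ℕ → Set (c ⊔ ℓ)
  HasRank {m} {k} M r =
    (∃ λ (f : Fin r → Fin k) → LinIndep (λ a → col M (f a)))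
    × (∀ (g : Fin (suc r) → Fin k) → ¬ LinIndep (λ a → col M (g a)))

  private
    idx-bound : {a b n : ℕ} → a + b ≤ suc (suc n) →
                (i : Fin a) (j : Fin b) → toℕ i + toℕ j < suc n
    idx-bound {a} {b} {n} h i j = ℕP.≤-pred (ℕP.≤-trans
      (ℕP.≤-trans (ℕP.≤-reflexive (sym (ℕP.+-suc (suc (toℕ i)) (toℕ j))))
                  (ℕP.+-mono-≤ (toℕ<n i) (toℕ<n j))) h)

  -- Hankel matrix with a rows and b columns, entries x_{i+j}, built from
  -- x = (x_0,…,x_n) ∈ F^{n+1}; requires (a-1)+(b-1) ≤ n, i.e. a+b ≤ n+2.
  -- H_{p,s}(x) of the paper is  hankel (p+1) (s+1) x _  (p = -1 or s = -1
  -- giving an empty matrix with 0 rows resp. 0 columns).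
  hankel : {n : ℕ} (a b : ℕ) → (Fin (suc n) → Carrier) →
           a + b ≤ suc (suc n) → Matrix a b
  hankel a b x h i j = x (fromℕ< (idx-bound h i j))

bound₁ : ∀ {p q n} → p + q ≤ suc n → suc p + q ≤ suc (suc n)
bound₁ h = s≤s h

bound₂ : ∀ {p q n} → p + q ≤ suc n → p + suc q ≤ suc (suc n)
bound₂ {p} {q} h = ℕP.≤-trans (ℕP.≤-reflexive (ℕP.+-suc p q)) (s≤s h)

{-# OPTIONS --safe #-}
-- Let u₀,…,u_{q-1} ∈ F^{p+1} be the columns of H_{p,q-1} and v₀,…,v_q ∈ F^p those of H_{p-1,q}:
-- dropping the last entry of u_j gives v_j, dropping the first gives v_{j+1}. Take a basis b of
-- the u's (r₁ vectors), a basis w of the v's (r₂ vectors), and let b̄ be b with last entries dropped.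
--
-- If r₂ < r₁ ≤ p, the r₁ vectors b̄ lie in the span of w and so satisfy a relation; lifting it to b
-- shows that the last unit vector e_p lies in span b. Then the relations among b̄ are the multiples
-- of one relation, so b̄ spans an (r₁ - 1)-dimensional space, which by r₂ < r₁ must contain v_q;
-- hence every v_j lies in span b̄. Dropping first entries turns e_{i+1} into the truncation of e_i,
-- so by downward induction all of e_0,…,e_p lie in span b, and p + 1 ≤ r₁.
--
-- If r₁ < r₂ ≤ q, the vectors b̄ are independent (otherwise v_q together with fewer than r₁ of them
-- would span all v's), so a relation among v₀,…,v_{q-1} lifts to a relation among the u's and
-- hence shifts to the same relation among v₁,…,v_q. Such relations exist since q > r₁, and shifting
-- one until its last coefficient is nonzero puts v_q into span b̄, which then contains all v's.
--
-- Equality in F is not decidable, so case distinctions are made in the double-negation monad; all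
-- conclusions drawn from them (⊥, or an inequality of natural numbers) are stable.

module Submission where

open import Defs
open import Level using (Level; _⊔_)
open import Data.Nat using (ℕ; zero; suc; _≤_; _<_; z≤n; s≤s)
import Data.Nat.Properties as ℕ
open import Data.Fin using (Fin; zero; suc; toℕ; fromℕ; inject₁; punchIn)
import Data.Fin.Properties as Fin
open import Data.Fin.Induction using (>-weakInduction)
open import Data.Vec.Functional using (Vector; _∷_; init; last; tail; insertAt; removeAt)
open import Data.Vec.Functional.Properties using (insertAt-lookup; insertAt-punchIn; insertAt-removeAt)
open import Data.Product using (Σ; ∃; _×_; _,_; proj₁; proj₂)
open import Function using (_∘_)
open import Relation.Nullary using (¬_; yes; no)
open import Relation.Nullary.Decidable using (decidable-stable; ¬¬-excluded-middle)
open import Relation.Binary.PropositionalEquality as ≡ using (_≡_)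
import Algebra.Properties.Semiring.Sum as Sum
import Algebra.Properties.Ring as RingProperties
import Data.Vec.Functional.Relation.Binary.Equality.Setoid as VecEquality

private
  variable
    ℓa ℓb : Level
    A : Set ℓa
    B : Set ℓb

infixl 1 _>>=_

_>>=_ : ¬ ¬ A → (A → ¬ ¬ B) → ¬ ¬ B
(m >>= f) k = m (λ x → f x k)

return : A → ¬ ¬ A
return x k = k x

¬¬-Π-Fin : ∀ {n} {P : Fin n → Set ℓa} → (∀ i → ¬ ¬ P i) → ¬ ¬ (∀ i → P i)
¬¬-Π-Fin {n = zero}  _ k = k λ ()
¬¬-Π-Fin {n = suc n} h = h zero >>= λ P₀ → ¬¬-Π-Fin (h ∘ suc) >>= λ Pₛ →
  return λ { zero → P₀ ; (suc i) → Pₛ i }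

insertAt-All : ∀ {n} {P : A → Set ℓb} (xs : Vector A n) (k : Fin (suc n)) {x : A} →
               P x → (∀ i → P (xs i)) → ∀ j → P (insertAt xs k x j)
insertAt-All                     xs zero    Px Pxs zero    = Px
insertAt-All                     xs zero    Px Pxs (suc j) = Pxs j
insertAt-All {n = suc n}         xs (suc k) Px Pxs zero    = Pxs zero
insertAt-All {n = suc n} {P = P} xs (suc k) Px Pxs (suc j) =
  insertAt-All {P = P} (tail xs) k Px (Pxs ∘ suc) j

module LinearAlgebra {ℓ₁ ℓ₂} (F : Field ℓ₁ ℓ₂) where
  open Field F hiding (zero)
  open Sum semiring using (sum; sum-cong-≋; sum-replicate-zero; sum-remove; sum-init-last;
    *-distribˡ-sum; *-distribʳ-sum)
  open RingProperties ring
    using (-1*x≈-x; x∙y⁻¹≈ε⇒x≈y; xyx⁻¹≈y; -‿distribˡ-*; -‿distribʳ-*; +-inverseˡ-unique)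
  open VecEquality setoid using (_≋_)
  open import Relation.Binary.Reasoning.Setoid setoid

  ∑≈sum : ∀ k (f : Vector Carrier k) → ∑ F k f ≈ sum f
  ∑≈sum zero    f = refl
  ∑≈sum (suc k) f = +-congˡ (∑≈sum k (f ∘ suc))

  ∑-cong : ∀ {k} {f g : Vector Carrier k} → f ≋ g → ∑ F k f ≈ ∑ F k g
  ∑-cong {k} {f} {g} f≋g = trans (∑≈sum k f) (trans (sum-cong-≋ f≋g) (sym (∑≈sum k g)))

  ∑-zero : ∀ {k} {f : Vector Carrier k} → (∀ i → f i ≈ 0#) → ∑ F k f ≈ 0#
  ∑-zero {k} f≈0 = trans (∑-cong f≈0) (trans (∑≈sum k _) (sum-replicate-zero k))

  ∑-distrib-+ : ∀ {k} (f g : Vector Carrier k) → ∑ F k (λ i → f i + g i) ≈ ∑ F k f + ∑ F k g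
  ∑-distrib-+ {k} f g = begin
    ∑ F k (λ i → f i + g i)   ≈⟨ ∑≈sum k _ ⟩
    sum (λ i → f i + g i)     ≈⟨ Sum.∑-distrib-+ semiring f g ⟩
    sum f + sum g             ≈⟨ +-cong (∑≈sum k f) (∑≈sum k g) ⟨
    ∑ F k f + ∑ F k g         ∎

  *-distribˡ-∑ : ∀ {k} z (f : Vector Carrier k) → z * ∑ F k f ≈ ∑ F k (λ i → z * f i)
  *-distribˡ-∑ {k} z f = begin
    z * ∑ F k f               ≈⟨ *-congˡ (∑≈sum k f) ⟩
    z * sum f                 ≈⟨ *-distribˡ-sum z f ⟩
    sum (λ i → z * f i)       ≈⟨ ∑≈sum k _ ⟨
    ∑ F k (λ i → z * f i)     ∎

  *-distribʳ-∑ : ∀ {k} z (f : Vector Carrier k) → ∑ F k f * z ≈ ∑ F k (λ i → f i * z)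
  *-distribʳ-∑ {k} z f = begin
    ∑ F k f * z               ≈⟨ *-congʳ (∑≈sum k f) ⟩
    sum f * z                 ≈⟨ *-distribʳ-sum z f ⟩
    sum (λ i → f i * z)       ≈⟨ ∑≈sum k _ ⟨
    ∑ F k (λ i → f i * z)     ∎

  ∑-comm : ∀ {k l} (f : Fin k → Fin l → Carrier) →
           ∑ F k (λ i → ∑ F l (f i)) ≈ ∑ F l (λ j → ∑ F k (λ i → f i j))
  ∑-comm {k} {l} f = begin
    ∑ F k (λ i → ∑ F l (f i))             ≈⟨ ∑≈sum k _ ⟩
    sum (λ i → ∑ F l (f i))               ≈⟨ sum-cong-≋ (λ i → ∑≈sum l (f i)) ⟩
    sum (λ i → sum (f i))                 ≈⟨ Sum.∑-comm semiring f ⟩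
    sum (λ j → sum (λ i → f i j))         ≈⟨ sum-cong-≋ (λ j → ∑≈sum k (λ i → f i j)) ⟨
    sum (λ j → ∑ F k (λ i → f i j))       ≈⟨ ∑≈sum l _ ⟨
    ∑ F l (λ j → ∑ F k (λ i → f i j))     ∎

  x*y≈0⇒x≈0 : ∀ {z w} → ¬ w ≈ 0# → z * w ≈ 0# → z ≈ 0#
  x*y≈0⇒x≈0 {z} {w} w≉0 zw≈0 = begin
    z             ≈⟨ *-identityʳ z ⟨
    z * 1#        ≈⟨ *-congˡ (proj₂ (inverse w w≉0)) ⟨
    z * (w * _)   ≈⟨ *-assoc z w _ ⟨
    z * w * _     ≈⟨ *-congʳ zw≈0 ⟩
    0# * _        ≈⟨ zeroˡ _ ⟩
    0#            ∎

  private
    variable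
      m r s t : ℕ
      x y : Vector Carrier m
      α β : Vector Carrier s
      g h : Fin s → Vector Carrier m

  0ᵛ : Vector Carrier m
  0ᵛ _ = 0#

  lincomb : Vector Carrier s → (Fin s → Vector Carrier m) → Vector Carrier m
  lincomb {s} α g i = ∑ F s (λ a → α a * g a i)

  lincomb-cong : (∀ a → α a ≈ β a) → (∀ a → g a ≋ h a) → lincomb α g ≋ lincomb β h
  lincomb-cong α≈β g≋h i = ∑-cong (λ a → *-cong (α≈β a) (g≋h a i))

  lincomb-zero : (∀ a → α a ≈ 0#) → lincomb α g ≋ 0ᵛ
  lincomb-zero α≈0 i = ∑-zero (λ a → trans (*-congʳ (α≈0 a)) (zeroˡ _))

  lincomb-* : ∀ z i → lincomb (λ a → z * α a) g i ≈ z * lincomb α g i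
  lincomb-* {s} {α} {g = g} z i = begin
    ∑ F s (λ a → z * α a * g a i)   ≈⟨ ∑-cong (λ a → *-assoc z (α a) (g a i)) ⟩
    ∑ F s (λ a → z * (α a * g a i)) ≈⟨ *-distribˡ-∑ z (λ a → α a * g a i) ⟨
    z * lincomb α g i               ∎

  lincomb-+ : ∀ i → lincomb (λ a → α a + β a) g i ≈ lincomb α g i + lincomb β g i
  lincomb-+ {s} {α} {β} {g = g} i = begin
    ∑ F s (λ a → (α a + β a) * g a i)         ≈⟨ ∑-cong (λ a → distribʳ (g a i) (α a) (β a)) ⟩
    ∑ F s (λ a → α a * g a i + β a * g a i)   ≈⟨ ∑-distrib-+ (λ a → α a * g a i) (λ a → β a * g a i) ⟩
    lincomb α g i + lincomb β g i             ∎

  lincomb-neg : ∀ i → lincomb (λ a → - α a) g i ≈ - lincomb α g i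
  lincomb-neg {α = α} {g = g} i = begin
    lincomb (λ a → - α a) g i        ≈⟨ lincomb-cong {g = g} (λ a → sym (-1*x≈-x (α a))) (λ _ _ → refl) i ⟩
    lincomb (λ a → - 1# * α a) g i   ≈⟨ lincomb-* {g = g} (- 1#) i ⟩
    - 1# * lincomb α g i             ≈⟨ -1*x≈-x _ ⟩
    - lincomb α g i                  ∎

  lincomb-lincomb : (C : Fin s → Vector Carrier r) → (∀ a → g a ≋ lincomb (C a) h) →
                    lincomb α g ≋ lincomb (lincomb α C) h
  lincomb-lincomb {s} {r} {g = g} {h} {α} C g≋Ch i = begin
    ∑ F s (λ a → α a * g a i)
      ≈⟨ ∑-cong (λ a → *-congˡ (g≋Ch a i)) ⟩
    ∑ F s (λ a → α a * ∑ F r (λ k → C a k * h k i))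
      ≈⟨ ∑-cong (λ a → *-distribˡ-∑ (α a) (λ k → C a k * h k i)) ⟩
    ∑ F s (λ a → ∑ F r (λ k → α a * (C a k * h k i)))
      ≈⟨ ∑-comm (λ a k → α a * (C a k * h k i)) ⟩
    ∑ F r (λ k → ∑ F s (λ a → α a * (C a k * h k i)))
      ≈⟨ ∑-cong (λ (k : Fin r) → ∑-cong (λ (a : Fin s) → *-assoc (α a) (C a k) (h k i))) ⟨
    ∑ F r (λ k → ∑ F s (λ a → α a * C a k * h k i))
      ≈⟨ ∑-cong (λ k → *-distribʳ-∑ (h k i) (λ a → α a * C a k)) ⟨
    lincomb (lincomb α C) h i ∎

  lincomb-removeAt : (α : Vector Carrier (suc s)) (g : Fin (suc s) → Vector Carrier m) (k : Fin (suc s)) →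
    ∀ i → lincomb α g i ≈ α k * g k i + lincomb (removeAt α k) (removeAt g k) i
  lincomb-removeAt {s} α g k i = begin
    ∑ F (suc s) f             ≈⟨ ∑≈sum (suc s) f ⟩
    sum f                     ≈⟨ sum-remove f ⟩
    f k + sum (removeAt f k)  ≈⟨ +-congˡ (∑≈sum s (removeAt f k)) ⟨
    f k + ∑ F s (removeAt f k) ∎
    where f = λ a → α a * g a i

  lincomb-init-last : (α : Vector Carrier (suc s)) (g : Fin (suc s) → Vector Carrier m) →
    ∀ i → lincomb α g i ≈ lincomb (init α) (init g) i + last α * last g i
  lincomb-init-last {s} α g i = begin
    ∑ F (suc s) f             ≈⟨ ∑≈sum (suc s) f ⟩
    sum f                     ≈⟨ sum-init-last f ⟩
    sum (init f) + last f     ≈⟨ +-congʳ (∑≈sum s (init f)) ⟨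
    ∑ F s (init f) + last f   ∎
    where f = λ a → α a * g a i

  _∈Span_ : Vector Carrier m → (Fin s → Vector Carrier m) → Set (ℓ₁ ⊔ ℓ₂)
  _∈Span_ {s = s} x g = Σ (Vector Carrier s) λ α → x ≋ lincomb α g

  Dependent : (Fin s → Vector Carrier m) → Set (ℓ₁ ⊔ ℓ₂)
  Dependent {s} g = Σ (Vector Carrier s) λ α → lincomb α g ≋ 0ᵛ × ∃ λ a → ¬ α a ≈ 0#

  LinIndep⇒¬Dependent : LinIndep F g → ¬ Dependent g
  LinIndep⇒¬Dependent li (α , rel , a , αa≉0) = αa≉0 (li α rel a)

  LinIndep-injective : LinIndep F g → lincomb α g ≋ lincomb β g → ∀ a → α a ≈ β a
  LinIndep-injective {g = g} {α = α} {β} li αg≋βg a =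
    x∙y⁻¹≈ε⇒x≈y (α a) (β a) (li (λ a → α a - β a) difference a)
    where
    difference : lincomb (λ a → α a - β a) g ≋ 0ᵛ
    difference i = begin
      lincomb (λ a → α a - β a) g i               ≈⟨ lincomb-+ {g = g} i ⟩
      lincomb α g i + lincomb (λ a → - β a) g i   ≈⟨ +-cong (αg≋βg i) (lincomb-neg {g = g} i) ⟩
      lincomb β g i - lincomb β g i               ≈⟨ -‿inverseʳ _ ⟩
      0#                                          ∎

  ∈Span-solve : ∀ {z} → ¬ z ≈ 0# → (∀ i → z * x i + lincomb α g i ≈ 0#) → x ∈Span g
  ∈Span-solve {x = x} {α = α} {g = g} {z} z≉0 rel = (λ a → - ι * α a) , λ i → begin
    x i                        ≈⟨ *-identityˡ (x i) ⟨
    1# * x i                   ≈⟨ *-congʳ (trans (*-comm ι z) zι≈1) ⟨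
    ι * z * x i                ≈⟨ *-assoc ι z (x i) ⟩
    ι * (z * x i)              ≈⟨ *-congˡ (+-inverseˡ-unique _ _ (rel i)) ⟩
    ι * - lincomb α g i        ≈⟨ -‿distribʳ-* ι _ ⟨
    - (ι * lincomb α g i)      ≈⟨ -‿distribˡ-* ι _ ⟩
    - ι * lincomb α g i        ≈⟨ lincomb-* {g = g} (- ι) i ⟨
    lincomb (λ a → - ι * α a) g i ∎
    where
    ι = proj₁ (inverse z z≉0)
    zι≈1 = proj₂ (inverse z z≉0)

  ∈Span-resp-≋ : x ≋ y → x ∈Span g → y ∈Span g
  ∈Span-resp-≋ x≋y (α , x≋αg) = α , λ i → trans (sym (x≋y i)) (x≋αg i)

  ∈Span-trans : x ∈Span g → (∀ a → g a ∈Span h) → x ∈Span h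
  ∈Span-trans (α , x≋αg) g∈h =
    lincomb α (proj₁ ∘ g∈h) , λ i → trans (x≋αg i) (lincomb-lincomb (proj₁ ∘ g∈h) (proj₂ ∘ g∈h) i)

  ¬¬∈Span-trans : ¬ ¬ (x ∈Span g) → (∀ a → ¬ ¬ (g a ∈Span h)) → ¬ ¬ (x ∈Span h)
  ¬¬∈Span-trans x∈g g∈h = x∈g >>= λ x∈g → ¬¬-Π-Fin g∈h >>= λ g∈h → return (∈Span-trans x∈g g∈h)

  ∈Span-∷ : x ∈Span g → x ∈Span (y ∷ g)
  ∈Span-∷ (α , x≋αg) = (0# ∷ α) , λ i → trans (x≋αg i) (sym (trans (+-congʳ (zeroˡ _)) (+-identityˡ _)))

  δ : Fin m → Vector Carrier m
  δ zero    zero    = 1#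
  δ zero    (suc _) = 0#
  δ (suc _) zero    = 0#
  δ (suc i) (suc j) = δ i j

  lincomb-δˡ : ∀ {s m} {g : Fin s → Vector Carrier m} a → lincomb (δ a) g ≋ g a
  lincomb-δˡ {suc s} zero    i = trans (+-cong (*-identityˡ _) (∑-zero {s} (λ _ → zeroˡ _))) (+-identityʳ _)
  lincomb-δˡ {g = g} (suc a) i = trans (+-cong (zeroˡ _) (lincomb-δˡ {g = tail g} a i)) (+-identityˡ _)

  lincomb-δʳ : ∀ {m} {α : Vector Carrier m} → lincomb α δ ≋ α
  lincomb-δʳ {suc m} zero    = trans (+-cong (*-identityʳ _) (∑-zero {m} (λ _ → zeroʳ _))) (+-identityʳ _)
  lincomb-δʳ         (suc i) = trans (+-cong (zeroʳ _) (lincomb-δʳ i)) (+-identityˡ _)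

  ∈Span-self : ∀ a → g a ∈Span g
  ∈Span-self {g = g} a = δ a , λ i → sym (lincomb-δˡ {g = g} a i)

  lincomb-insertAt : (c : Vector Carrier s) (k : Fin (suc s)) (z : Carrier)
                     (g : Fin (suc s) → Vector Carrier m) →
    ∀ i → lincomb (insertAt c k z) g i ≈ z * g k i + lincomb c (removeAt g k) i
  lincomb-insertAt c k z g i = begin
    lincomb (insertAt c k z) g i
      ≈⟨ lincomb-removeAt (insertAt c k z) g k i ⟩
    insertAt c k z k * g k i + lincomb (removeAt (insertAt c k z) k) (removeAt g k) i
      ≈⟨ +-cong (*-congʳ (reflexive (insertAt-lookup c k z)))
                (lincomb-cong {g = removeAt g k} (λ b → reflexive (insertAt-punchIn c k z b))
                              (λ _ _ → refl) i) ⟩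
    z * g k i + lincomb c (removeAt g k) i ∎

  -- A relation c among the reduced vectors is the relation insertAt c k (- weight c) among w.
  module PivotElimination (w : Fin (suc s) → Vector Carrier (suc m)) (k : Fin (suc s))
                          (pivot≉0 : ¬ w k zero ≈ 0#) where

    multiplier : Fin s → Carrier
    multiplier b = w (punchIn k b) zero * proj₁ (inverse _ pivot≉0)

    reduced : Fin s → Vector Carrier m
    reduced b i = w (punchIn k b) (suc i) - multiplier b * w k (suc i)

    weight : Vector Carrier s → Carrier
    weight c = ∑ F s (λ b → c b * multiplier b)

    multiplier-pivot : ∀ b → multiplier b * w k zero ≈ w (punchIn k b) zero
    multiplier-pivot b = begin
      w (punchIn k b) zero * ι * w k zero   ≈⟨ *-assoc _ ι _ ⟩
      w (punchIn k b) zero * (ι * w k zero) ≈⟨ *-congˡ (trans (*-comm ι _) (proj₂ (inverse _ pivot≉0))) ⟩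
      w (punchIn k b) zero * 1#             ≈⟨ *-identityʳ _ ⟩
      w (punchIn k b) zero                  ∎
      where ι = proj₁ (inverse _ pivot≉0)

    lincomb-insertAt-zero : ∀ c z → lincomb (insertAt c k z) w zero ≈ (z + weight c) * w k zero
    lincomb-insertAt-zero c z = begin
      lincomb (insertAt c k z) w zero
        ≈⟨ lincomb-insertAt c k z w zero ⟩
      z * w k zero + ∑ F s (λ b → c b * w (punchIn k b) zero)
        ≈⟨ +-congˡ (∑-cong (λ b → *-congˡ (multiplier-pivot b))) ⟨
      z * w k zero + ∑ F s (λ b → c b * (multiplier b * w k zero))
        ≈⟨ +-congˡ (∑-cong (λ b → *-assoc (c b) _ _)) ⟨
      z * w k zero + ∑ F s (λ b → c b * multiplier b * w k zero)
        ≈⟨ +-congˡ (*-distribʳ-∑ (w k zero) (λ b → c b * multiplier b)) ⟨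
      z * w k zero + weight c * w k zero                      ≈⟨ distribʳ _ z _ ⟨
      (z + weight c) * w k zero                               ∎

    lincomb-insertAt-suc : ∀ c z i →
      lincomb (insertAt c k z) w (suc i) ≈ (z + weight c) * w k (suc i) + lincomb c reduced i
    lincomb-insertAt-suc c z i = begin
      lincomb (insertAt c k z) w (suc i)
        ≈⟨ lincomb-insertAt c k z w (suc i) ⟩
      z * W + ∑ F s (λ b → c b * w (punchIn k b) (suc i))
        ≈⟨ +-congˡ (∑-cong (λ b → *-congˡ (unreduce b))) ⟨
      z * W + ∑ F s (λ b → c b * (reduced b i + multiplier b * W))
        ≈⟨ +-congˡ (∑-cong (λ b → trans (distribˡ (c b) _ _) (+-congˡ (sym (*-assoc (c b) _ _))))) ⟩
      z * W + ∑ F s (λ b → c b * reduced b i + c b * multiplier b * W)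
        ≈⟨ +-congˡ (∑-distrib-+ (λ b → c b * reduced b i) (λ b → c b * multiplier b * W)) ⟩
      z * W + (lincomb c reduced i + ∑ F s (λ b → c b * multiplier b * W))
        ≈⟨ +-congˡ (+-congˡ (*-distribʳ-∑ W (λ b → c b * multiplier b))) ⟨
      z * W + (lincomb c reduced i + weight c * W)         ≈⟨ +-congˡ (+-comm _ _) ⟩
      z * W + (weight c * W + lincomb c reduced i)         ≈⟨ +-assoc _ _ _ ⟨
      z * W + weight c * W + lincomb c reduced i           ≈⟨ +-congʳ (distribʳ W z _) ⟨
      (z + weight c) * W + lincomb c reduced i             ∎
      where
      W = w k (suc i)
      unreduce : ∀ b → reduced b i + multiplier b * W ≈ w (punchIn k b) (suc i)
      unreduce b = trans (+-assoc _ _ _) (trans (+-congˡ (-‿inverseˡ _)) (+-identityʳ _))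

    ¬Dependent-reduced : ¬ Dependent w → ¬ Dependent reduced
    ¬Dependent-reduced ¬dep (c , rel , b , cb≉0) =
      ¬dep (insertAt c k (- weight c) , rel′ , punchIn k b ,
            cb≉0 ∘ trans (reflexive (≡.sym (insertAt-punchIn c k _ b))))
      where
      cancelled : ∀ z → (- weight c + weight c) * z ≈ 0#
      cancelled z = trans (*-congʳ (-‿inverseˡ _)) (zeroˡ z)
      rel′ : lincomb (insertAt c k (- weight c)) w ≋ 0ᵛ
      rel′ zero    = trans (lincomb-insertAt-zero c _) (cancelled _)
      rel′ (suc i) =
        trans (lincomb-insertAt-suc c _ i) (trans (+-cong (cancelled _) (rel i)) (+-identityˡ _))

    LinIndep-reduced⇒LinIndep : LinIndep F reduced → LinIndep F w
    LinIndep-reduced⇒LinIndep li d rel j =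
      trans (reflexive (≡.sym (insertAt-removeAt d k j))) (insertAt-All {P = _≈ 0#} c k z≈0 c≈0 j)
      where
      c = removeAt d k
      z = d k
      rel′ : lincomb (insertAt c k z) w ≋ 0ᵛ
      rel′ i = trans (lincomb-cong {g = w} (λ j → reflexive (insertAt-removeAt d k j)) (λ _ _ → refl) i)
                     (rel i)
      z+weight≈0 : z + weight c ≈ 0#
      z+weight≈0 = x*y≈0⇒x≈0 pivot≉0 (trans (sym (lincomb-insertAt-zero c z)) (rel′ zero))
      c≈0 : ∀ b → c b ≈ 0#
      c≈0 = li c λ i → begin
        lincomb c reduced i                             ≈⟨ +-identityˡ _ ⟨
        0# + lincomb c reduced i                        ≈⟨ +-congʳ (trans (*-congʳ z+weight≈0) (zeroˡ _)) ⟨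
        (z + weight c) * w k (suc i) + lincomb c reduced i ≈⟨ lincomb-insertAt-suc c z i ⟨
        lincomb (insertAt c k z) w (suc i)              ≈⟨ rel′ (suc i) ⟩
        0#                                              ∎
      z≈0 : z ≈ 0#
      z≈0 = begin
        z              ≈⟨ +-identityʳ z ⟨
        z + 0#         ≈⟨ +-congˡ (∑-zero (λ b → trans (*-congʳ (c≈0 b)) (zeroˡ _))) ⟨
        z + weight c   ≈⟨ z+weight≈0 ⟩
        0#             ∎

  ¬Dependent⇒¬¬[LinIndep×≤] : {w : Fin s → Vector Carrier m} → ¬ Dependent w → ¬ ¬ (LinIndep F w × s ≤ m)
  ¬Dependent⇒¬¬[LinIndep×≤] {zero}           _    = return ((λ _ _ ()) , z≤n)
  ¬Dependent⇒¬¬[LinIndep×≤] {suc s} {zero}   ¬dep _ = ¬dep ((λ _ → 1#) , (λ ()) , zero , 0≉1 ∘ sym)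
  ¬Dependent⇒¬¬[LinIndep×≤] {suc s} {suc m} {w} ¬dep =
    ¬¬-excluded-middle {A = ∃ λ k → ¬ w k zero ≈ 0#} >>= λ where
      (yes (k , pivot≉0)) → let open PivotElimination w k pivot≉0 in
        ¬Dependent⇒¬¬[LinIndep×≤] (¬Dependent-reduced ¬dep) >>= λ (li , s≤m) →
        return (LinIndep-reduced⇒LinIndep li , s≤s s≤m)
      (no no-pivot) → ¬¬-Π-Fin (λ k pivot≉0 → no-pivot (k , pivot≉0)) >>= λ column≈0 →
        ¬Dependent⇒¬¬[LinIndep×≤] {w = tail ∘ w} (¬Dependent-tail column≈0) >>= λ (li , s<m) →
        return ((λ α rel → li α (rel ∘ suc)) , ℕ.m≤n⇒m≤1+n s<m)
    where
    ¬Dependent-tail : (∀ k → w k zero ≈ 0#) → ¬ Dependent (tail ∘ w)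
    ¬Dependent-tail column≈0 (α , rel , a , αa≉0) = ¬dep (α , rel′ , a , αa≉0)
      where
      rel′ : lincomb α w ≋ 0ᵛ
      rel′ zero    = ∑-zero (λ b → trans (*-congˡ (column≈0 b)) (zeroʳ (α b)))
      rel′ (suc i) = rel i

  ¬Dependent⇒≤ : {w : Fin s → Vector Carrier m} → ¬ Dependent w → s ≤ m
  ¬Dependent⇒≤ {s} {m} ¬dep =
    decidable-stable (s ℕ.≤? m) (¬Dependent⇒¬¬[LinIndep×≤] ¬dep >>= return ∘ proj₂)

  Steinitz : {w : Fin s → Vector Carrier m} {h : Fin r → Vector Carrier m} →
             ¬ Dependent w → (∀ a → ¬ ¬ (w a ∈Span h)) → s ≤ r
  Steinitz {s} {r = r} {w} {h} ¬dep w∈h = decidable-stable (s ℕ.≤? r) (¬¬-Π-Fin w∈h >>= λ w∈h →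
    return (¬Dependent⇒≤ λ (α , rel , a , αa≉0) →
      ¬dep (α , (λ i → trans (lincomb-lincomb (proj₁ ∘ w∈h) (proj₂ ∘ w∈h) i) (lincomb-zero {g = h} rel i)) ,
            a , αa≉0)))

  ¬∈Span⇒¬Dependent-∷ : LinIndep F g → ¬ x ∈Span g → ¬ Dependent (x ∷ g)
  ¬∈Span⇒¬Dependent-∷ {g = g} {x = x} li x∉g (α , rel , a , αa≉0) =
    ¬¬α₀≈0 λ α₀≈0 → αa≉0 (all-zero α₀≈0 a)
    where
    ¬¬α₀≈0 : ¬ ¬ (α zero ≈ 0#)
    ¬¬α₀≈0 α₀≉0 = x∉g (∈Span-solve α₀≉0 rel)
    all-zero : α zero ≈ 0# → ∀ a → α a ≈ 0#
    all-zero α₀≈0 zero    = α₀≈0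
    all-zero α₀≈0 (suc a) = li (tail α) (λ i → begin
      lincomb (tail α) g i                  ≈⟨ +-identityˡ _ ⟨
      0# + lincomb (tail α) g i             ≈⟨ +-congʳ (trans (*-congʳ α₀≈0) (zeroˡ (x i))) ⟨
      α zero * x i + lincomb (tail α) g i   ≈⟨ rel i ⟩
      0#                                    ∎) a

  module _ {k} {M : Matrix F m k} where

    basis : HasRank F M r → Fin r → Vector Carrier m
    basis rank a = col F M (proj₁ (proj₁ rank) a)

    basis-LinIndep : (rank : HasRank F M r) → LinIndep F (basis rank)
    basis-LinIndep rank = proj₂ (proj₁ rank)

    col∈Span-basis : (rank : HasRank F M r) → ∀ j → ¬ ¬ (col F M j ∈Span basis rank)
    col∈Span-basis ((f , li) , maximal) j col∉basis =
      ¬Dependent⇒¬¬[LinIndep×≤] {w = col F M j ∷ col F M ∘ f} (¬∈Span⇒¬Dependent-∷ li col∉basis)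
        λ (li′ , _) → maximal (j ∷ f) li′

  ∈Span-removeAt : (h : Fin (suc s) → Vector Carrier m) {α : Vector Carrier (suc s)} {k : Fin (suc s)} →
                   lincomb α h ≋ 0ᵛ → ¬ α k ≈ 0# → ∀ a → h a ∈Span removeAt h k
  ∈Span-removeAt h {α} {k} rel αk≉0 a = ≡.subst (_∈Span removeAt h k) (insertAt-removeAt h k a)
    (insertAt-All {P = _∈Span removeAt h k} (removeAt h k) k
      (∈Span-solve {α = removeAt α k} αk≉0 (λ i → trans (sym (lincomb-removeAt α h k i)) (rel i)))
      (∈Span-self {g = removeAt h k}) a)

  Steinitz-∷-Dependent : {w : Fin t → Vector Carrier m} {h : Fin s → Vector Carrier m} →
    ¬ Dependent w → Dependent h → (∀ a → ¬ ¬ (w a ∈Span (x ∷ h))) → t ≤ s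
  Steinitz-∷-Dependent {s = suc s} {x = x} {h = h} ¬dep (α , rel , k , αk≉0) w∈x∷h =
    Steinitz {h = x ∷ removeAt h k} ¬dep λ a →
      ¬¬∈Span-trans {g = x ∷ h} {h = x ∷ removeAt h k} (w∈x∷h a) (return ∘ x∷h⊆)
    where
    x∷h⊆ : ∀ a → (x ∷ h) a ∈Span (x ∷ removeAt h k)
    x∷h⊆ zero    = ∈Span-self {g = x ∷ removeAt h k} zero
    x∷h⊆ (suc a) = ∈Span-∷ {y = x} (∈Span-removeAt h {α} {k} rel αk≉0 a)

  init≈0⇒≋last*δ : (y : Vector Carrier (suc m)) → init y ≋ 0ᵛ → ∀ i → y i ≈ last y * δ (fromℕ m) i
  init≈0⇒≋last*δ {zero}  y _      zero    = sym (*-identityʳ _)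
  init≈0⇒≋last*δ {suc m} y init≈0 zero    = trans (init≈0 zero) (sym (zeroʳ _))
  init≈0⇒≋last*δ {suc m} y init≈0 (suc i) = init≈0⇒≋last*δ (tail y) (init≈0 ∘ suc) i

  init-δ-inject₁ : ∀ (a : Fin m) → init (δ (inject₁ a)) ≋ δ a
  init-δ-inject₁ zero    zero    = refl
  init-δ-inject₁ zero    (suc j) = refl
  init-δ-inject₁ (suc a) zero    = refl
  init-δ-inject₁ (suc a) (suc j) = init-δ-inject₁ a j

  module LastCoordinate {b : Fin s → Vector Carrier (suc m)} (b-indep : LinIndep F b) where

    δ-last∈Span : ∀ {d k} → lincomb d (init ∘ b) ≋ 0ᵛ → ¬ d k ≈ 0# →
                  Σ (Vector Carrier s) λ κ → δ (fromℕ m) ≋ lincomb κ b × ¬ κ k ≈ 0#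
    δ-last∈Span {d} {k} rel dk≉0 = (λ a → ι * d a) , κ-spec , κk≉0
      where
      comb = lincomb d b
      shape : ∀ i → comb i ≈ last comb * δ (fromℕ m) i
      shape = init≈0⇒≋last*δ comb rel
      last≉0 : ¬ last comb ≈ 0#
      last≉0 last≈0 = dk≉0 (b-indep d (λ i → trans (shape i) (trans (*-congʳ last≈0) (zeroˡ _))) k)
      ι = proj₁ (inverse (last comb) last≉0)
      combι≈1 = proj₂ (inverse (last comb) last≉0)
      κ-spec : δ (fromℕ m) ≋ lincomb (λ a → ι * d a) b
      κ-spec i = sym (begin
        lincomb (λ a → ι * d a) b i      ≈⟨ lincomb-* {g = b} ι i ⟩
        ι * comb i                       ≈⟨ *-congˡ (shape i) ⟩
        ι * (last comb * δ (fromℕ m) i)  ≈⟨ *-assoc ι _ _ ⟨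
        ι * last comb * δ (fromℕ m) i    ≈⟨ *-congʳ (trans (*-comm ι _) combι≈1) ⟩
        1# * δ (fromℕ m) i               ≈⟨ *-identityˡ _ ⟩
        δ (fromℕ m) i                    ∎)
      ι≉0 : ¬ ι ≈ 0#
      ι≉0 ι≈0 = 0≉1 (trans (sym (zeroʳ (last comb))) (trans (*-congˡ (sym ι≈0)) combι≈1))
      κk≉0 : ¬ ι * d k ≈ 0#
      κk≉0 ιdk≈0 = dk≉0 (x*y≈0⇒x≈0 ι≉0 (trans (*-comm _ ι) ιdk≈0))

    init-relation-multiple : ∀ {κ d} → δ (fromℕ m) ≋ lincomb κ b → lincomb d (init ∘ b) ≋ 0ᵛ →
                             ∀ a → d a ≈ last (lincomb d b) * κ a
    init-relation-multiple {κ} {d} κ-spec rel = LinIndep-injective b-indep λ i → begin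
      lincomb d b i                       ≈⟨ init≈0⇒≋last*δ (lincomb d b) rel i ⟩
      last (lincomb d b) * δ (fromℕ m) i  ≈⟨ *-congˡ (κ-spec i) ⟩
      last (lincomb d b) * lincomb κ b i  ≈⟨ lincomb-* {g = b} _ i ⟨
      lincomb (λ a → last (lincomb d b) * κ a) b i ∎

    ∈Span-from-init : δ (fromℕ m) ∈Span b → init x ∈Span (init ∘ b) → x ∈Span b
    ∈Span-from-init {x = x} (κ , κ-spec) (β , init-x≋) = (λ a → β a + τ * κ a) , λ i → begin
      x i                                     ≈⟨ xyx⁻¹≈y (z i) (x i) ⟨
      z i + x i - z i                         ≈⟨ +-assoc (z i) (x i) _ ⟩
      z i + (x i - z i)                       ≈⟨ +-congˡ (init≈0⇒≋last*δ (λ j → x j - z j) difference-init i) ⟩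
      z i + τ * δ (fromℕ m) i                 ≈⟨ +-congˡ (*-congˡ (κ-spec i)) ⟩
      z i + τ * lincomb κ b i                 ≈⟨ +-congˡ (lincomb-* {g = b} τ i) ⟨
      z i + lincomb (λ a → τ * κ a) b i       ≈⟨ lincomb-+ {g = b} i ⟨
      lincomb (λ a → β a + τ * κ a) b i       ∎
      where
      z = lincomb β b
      τ = last x - last z
      difference-init : ∀ j → x (inject₁ j) - z (inject₁ j) ≈ 0#
      difference-init j = trans (+-congʳ (init-x≋ j)) (-‿inverseʳ _)

    tail∈Span-init⇒≤ : δ (fromℕ m) ∈Span b → (∀ a → ¬ ¬ (tail (b a) ∈Span (init ∘ b))) → suc m ≤ s
    tail∈Span-init⇒≤ δ-last∈b tail∈init =
      Steinitz (LinIndep⇒¬Dependent {g = δ} λ α rel i → trans (sym (lincomb-δʳ {α = α} i)) (rel i)) δ∈Span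
      where
      δ∈Span : ∀ i → ¬ ¬ (δ i ∈Span b)
      δ∈Span = >-weakInduction (λ i → ¬ ¬ (δ i ∈Span b)) (return δ-last∈b) λ i δ₊∈b →
        δ₊∈b >>= λ (α , δ₊≋) →
        ¬¬∈Span-trans {g = tail ∘ b} {h = init ∘ b} (return (α , δ₊≋ ∘ suc)) tail∈init >>= λ δ∈init →
        return (∈Span-from-init δ-last∈b (∈Span-resp-≋ (sym ∘ init-δ-inject₁ i) δ∈init))

  -- The relations among init ∘ b are the multiples of one relation κ with κ k ≉ 0, so removing the
  -- k-th vector leaves an independent family, which x extends.
  ¬∈Span-init⇒≤ : ∀ {s m t} {b : Fin s → Vector Carrier (suc m)} {x} {g : Fin t → Vector Carrier m} →
    LinIndep F b → Dependent (init ∘ b) → ¬ x ∈Span (init ∘ b) →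
    ¬ ¬ (x ∈Span g) → (∀ a → ¬ ¬ (init (b a) ∈Span g)) → s ≤ t
  ¬∈Span-init⇒≤ {suc s} {b = b} {x} {g} b-indep (d , rel , k , dk≉0) x∉b̄ x∈g b̄∈g =
    Steinitz {w = x ∷ removeAt b̄ k} {h = g} (¬∈Span⇒¬Dependent-∷ b̄∖k-indep x∉b̄∖k) λ where
      zero    → x∈g
      (suc a) → b̄∈g (punchIn k a)
    where
    open LastCoordinate {b = b} b-indep
    b̄ = init ∘ b
    κ = proj₁ (δ-last∈Span {d} {k} rel dk≉0)
    κ-spec = proj₁ (proj₂ (δ-last∈Span {d} {k} rel dk≉0))
    κk≉0 = proj₂ (proj₂ (δ-last∈Span {d} {k} rel dk≉0))
    b̄∖k-indep : LinIndep F (removeAt b̄ k)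
    b̄∖k-indep e rel a = begin
      e a                           ≡⟨ insertAt-punchIn e k 0# a ⟨
      e′ (punchIn k a)              ≈⟨ init-relation-multiple {κ} {e′} κ-spec rel′ (punchIn k a) ⟩
      last (lincomb e′ b) * κ (punchIn k a) ≈⟨ *-congʳ coefficient≈0 ⟩
      0# * κ (punchIn k a)          ≈⟨ zeroˡ _ ⟩
      0#                            ∎
      where
      e′ = insertAt e k 0#
      rel′ : lincomb e′ b̄ ≋ 0ᵛ
      rel′ i = trans (lincomb-insertAt e k 0# b̄ i)
                     (trans (+-congʳ (zeroˡ _)) (trans (+-identityˡ _) (rel i)))
      coefficient≈0 : last (lincomb e′ b) ≈ 0#
      coefficient≈0 = x*y≈0⇒x≈0 κk≉0
        (trans (sym (init-relation-multiple {κ} {e′} κ-spec rel′ k))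
               (reflexive (insertAt-lookup e k 0#)))
    x∉b̄∖k : ¬ x ∈Span removeAt b̄ k
    x∉b̄∖k x∈b̄∖k = x∉b̄ (∈Span-trans {h = b̄} x∈b̄∖k (∈Span-self {g = b̄} ∘ punchIn k))

  last∈Span-init : ∀ {q} (v : Fin (suc q) → Vector Carrier m) →
    (∀ c → lincomb c (init v) ≋ 0ᵛ → ¬ ¬ (lincomb c (tail v) ≋ 0ᵛ)) →
    Dependent (init v) → ¬ ¬ (last v ∈Span init v)
  last∈Span-init {q = suc q} v shift (c , rel , j , cj≉0) =
    >-weakInduction P from-last-coefficient step j c rel cj≉0
    where
    P : Fin (suc q) → Set _
    P j = ∀ c → lincomb c (init v) ≋ 0ᵛ → ¬ c j ≈ 0# → ¬ ¬ (last v ∈Span init v)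

    tail-split : ∀ c i → lincomb c (tail v) i ≈ lincomb (0# ∷ init c) (init v) i + last c * last v i
    tail-split c i = trans (lincomb-init-last c (tail v) i)
                           (+-congʳ (sym (trans (+-congʳ (zeroˡ _)) (+-identityˡ _))))

    solve-last : ∀ c → lincomb c (tail v) ≋ 0ᵛ → ¬ last c ≈ 0# → last v ∈Span init v
    solve-last c rel last≉0 =
      ∈Span-solve {α = 0# ∷ init c} {g = init v} last≉0 λ i →
        trans (+-comm _ _) (trans (sym (tail-split c i)) (rel i))

    from-last-coefficient : P (fromℕ q)
    from-last-coefficient c rel last≉0 = shift c rel >>= λ rel₊ → return (solve-last c rel₊ last≉0)

    step : ∀ i → P (suc i) → P (inject₁ i)
    step i P₊ c rel ci≉0 = shift c rel >>= λ rel₊ → ¬¬-excluded-middle >>= λ where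
      (no last≉0) → return (solve-last c rel₊ last≉0)
      (yes last≈0) → P₊ (0# ∷ init c) (λ i → begin
        lincomb (0# ∷ init c) (init v) i                     ≈⟨ +-identityʳ _ ⟨
        lincomb (0# ∷ init c) (init v) i + 0#                ≈⟨ +-congˡ (trans (*-congʳ last≈0) (zeroˡ _)) ⟨
        lincomb (0# ∷ init c) (init v) i + last c * last v i ≈⟨ tail-split c i ⟨
        lincomb c (tail v) i                                 ≈⟨ rel₊ i ⟩
        0#                                                   ∎) ci≉0

  module ShiftedColumns {p q : ℕ}
    (u : Fin q → Vector Carrier (suc p)) (v : Fin (suc q) → Vector Carrier p)
    (init-u : ∀ j → init (u j) ≋ v (inject₁ j)) (tail-u : ∀ j → tail (u j) ≋ v (suc j))
    {r₁ r₂ : ℕ} (rank-u : HasRank F (λ i j → u j i) r₁) (rank-v : HasRank F (λ i j → v j i) r₂)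
    where

    U : Matrix F (suc p) q
    U i j = u j i

    V : Matrix F p (suc q)
    V i j = v j i

    b = basis {M = U} rank-u
    w = basis {M = V} rank-v
    b̄ = init ∘ b
    b-index = proj₁ (proj₁ rank-u)
    w-index = proj₁ (proj₁ rank-v)

    b̄∈Span-w : ∀ a → ¬ ¬ (b̄ a ∈Span w)
    b̄∈Span-w a = col∈Span-basis {M = V} rank-v (inject₁ (b-index a)) >>= λ v∈w →
      return (∈Span-resp-≋ (sym ∘ init-u (b-index a)) v∈w)

    init-v∈Span-b̄ : ∀ j → ¬ ¬ (v (inject₁ j) ∈Span b̄)
    init-v∈Span-b̄ j = col∈Span-basis {M = U} rank-u j >>= λ (α , u≋αb) →
      return (α , λ i → trans (sym (init-u j i)) (u≋αb (inject₁ i)))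

    v∈Span : ∀ {h : Fin s → Vector Carrier p} → ¬ ¬ (last v ∈Span h) → (∀ a → b̄ a ∈Span h) →
             ∀ j → ¬ ¬ (v j ∈Span h)
    v∈Span {h = h} last∈h b̄∈h = >-weakInduction (λ j → ¬ ¬ (v j ∈Span h)) last∈h
      λ j _ → ¬¬∈Span-trans (init-v∈Span-b̄ j) (return ∘ b̄∈h)

    w-independent : ¬ Dependent w
    w-independent = LinIndep⇒¬Dependent (basis-LinIndep {M = V} rank-v)

    r₂≮r₁ : r₁ ≤ p → ¬ r₂ < r₁
    r₂≮r₁ r₁≤p r₂<r₁ = b̄-dependent λ dep@(d , rel , k , dk≉0) → last-v∈b̄ dep λ last-v∈b̄ →
      let κ , κ-spec , _ = δ-last∈Span {d} {k} rel dk≉0 in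
      ℕ.<⇒≱ (s≤s r₁≤p) (tail∈Span-init⇒≤ (κ , κ-spec) (tail-b∈Span-b̄ last-v∈b̄))
      where
      b-indep = basis-LinIndep {M = U} rank-u
      open LastCoordinate b-indep using (δ-last∈Span; tail∈Span-init⇒≤)
      b̄-dependent : ¬ ¬ Dependent b̄
      b̄-dependent ¬dep = ℕ.<⇒≱ r₂<r₁ (Steinitz ¬dep b̄∈Span-w)
      tail-b∈Span-b̄ : last v ∈Span b̄ → ∀ a → ¬ ¬ (tail (b a) ∈Span b̄)
      tail-b∈Span-b̄ last-v∈b̄ a = v∈Span (return last-v∈b̄) (∈Span-self {g = b̄}) (suc (b-index a)) >>= λ v∈b̄ →
        return (∈Span-resp-≋ (sym ∘ tail-u (b-index a)) v∈b̄)
      last-v∈b̄ : Dependent b̄ → ¬ ¬ (last v ∈Span b̄)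
      last-v∈b̄ dep last-v∉b̄ =
        ℕ.<⇒≱ r₂<r₁ (¬∈Span-init⇒≤ b-indep dep last-v∉b̄ (col∈Span-basis {M = V} rank-v (fromℕ q))
                                    b̄∈Span-w)

    r₁≮r₂ : r₂ ≤ q → ¬ r₁ < r₂
    r₁≮r₂ r₂≤q r₁<r₂ = init-v-dependent λ dep → last∈Span-init v shifted-relation dep λ last-v∈init-v →
      ℕ.<⇒≱ r₁<r₂ (Steinitz w-independent λ a →
        v∈Span (¬¬∈Span-trans (return last-v∈init-v) init-v∈Span-b̄) (∈Span-self {g = b̄})
               (w-index a))
      where
      b̄-independent : ¬ Dependent b̄
      b̄-independent dep = ℕ.<⇒≱ r₁<r₂ (Steinitz-∷-Dependent {x = last v} w-independent dep λ a →
        v∈Span {h = last v ∷ b̄} (return (∈Span-self {g = last v ∷ b̄} zero)) (∈Span-self {g = last v ∷ b̄} ∘ suc)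
               (w-index a))
      init-v-dependent : ¬ ¬ Dependent (init v)
      init-v-dependent ¬dep = ℕ.<⇒≱ (ℕ.<-≤-trans r₁<r₂ r₂≤q) (Steinitz ¬dep init-v∈Span-b̄)
      shifted-relation : ∀ c → lincomb c (init v) ≋ 0ᵛ → ¬ ¬ (lincomb c (tail v) ≋ 0ᵛ)
      shifted-relation c rel =
        ¬¬-Π-Fin (col∈Span-basis {M = U} rank-u) >>= λ u∈b →
        ¬Dependent⇒¬¬[LinIndep×≤] b̄-independent >>= λ (b̄-indep , _) →
        let u-comb = lincomb-lincomb {g = u} {h = b} {α = c} (proj₁ ∘ u∈b) (proj₂ ∘ u∈b)
            γ≈0 = b̄-indep (lincomb c (proj₁ ∘ u∈b)) λ i →
              trans (sym (u-comb (inject₁ i))) (trans (lincomb-cong (λ _ → refl) init-u i) (rel i))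
        in return λ i → trans (lincomb-cong (λ _ → refl) (λ j → sym ∘ tail-u j) i)
                              (trans (u-comb (suc i)) (lincomb-zero {g = b} γ≈0 (suc i)))

    ranks-equal : r₁ ≤ p → r₂ ≤ q → r₁ ≡ r₂
    ranks-equal r₁≤p r₂≤q = ℕ.≤-antisym (ℕ.≮⇒≥ (r₂≮r₁ r₁≤p)) (ℕ.≮⇒≥ (r₁≮r₂ r₂≤q))

open import Data.Nat using (_+_)

hankel-≡ : ∀ {ℓ₁ ℓ₂} (F : Field ℓ₁ ℓ₂) {n a b a′ b′ : ℕ} (x : Fin (suc n) → Field.Carrier F)
  (h : a + b ≤ suc (suc n)) (h′ : a′ + b′ ≤ suc (suc n))
  (i : Fin a) (j : Fin b) (i′ : Fin a′) (j′ : Fin b′) →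
  toℕ i + toℕ j ≡ toℕ i′ + toℕ j′ → hankel F a b x h i j ≡ hankel F a′ b′ x h′ i′ j′
hankel-≡ F x h h′ i j i′ j′ eq = ≡.cong x (Fin.fromℕ<-cong _ _ eq _ _)

lemma2p3 : ∀ {c ℓ : Level} (F : Field c ℓ) (n p q : ℕ) (h : p + q ≤ suc n)
    (x : Fin (suc n) → Field.Carrier F) (r₁ r₂ : ℕ) →
    HasRank F (hankel F (suc p) q x (bound₁ {p} {q} h)) r₁ →
    HasRank F (hankel F p (suc q) x (bound₂ {p} {q} h)) r₂ →
    r₁ ≤ p → r₂ ≤ q → r₁ ≡ r₂
lemma2p3 F n p q h x r₁ r₂ rank₁ rank₂ =
  ShiftedColumns.ranks-equal (col F H₁) (col F H₂) init-col tail-col rank₁ rank₂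
  where
  open LinearAlgebra F
  open Field F using (_≈_; reflexive)
  H₁ = hankel F (suc p) q x (bound₁ {p} {q} h)
  H₂ = hankel F p (suc q) x (bound₂ {p} {q} h)
  init-col : ∀ j i → H₁ (inject₁ i) j ≈ H₂ i (inject₁ j)
  init-col j i = reflexive (hankel-≡ F x (bound₁ {p} {q} h) (bound₂ {p} {q} h) (inject₁ i) j i (inject₁ j)
    (≡.cong₂ _+_ (Fin.toℕ-inject₁ i) (≡.sym (Fin.toℕ-inject₁ j))))
  tail-col : ∀ j i → H₁ (suc i) j ≈ H₂ i (suc j)
  tail-col j i = reflexive (hankel-≡ F x (bound₁ {p} {q} h) (bound₂ {p} {q} h) (suc i) j i (suc j)
    (≡.sym (ℕ.+-suc (toℕ i) (toℕ j))))
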